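{- Let $d,b\ge1$ be integers. If there exists a boolean function $f:\{0,1\}^n\to\{0,1\}$ with $\deg(f)=d$ and $\mathrm{bs}(f)=b$, then there exist $\tau\in\{0,1\}$ and $p\in\mathbb{R}^d$ such that \[ \langle p, m_d(1)\rangle = 1,\qquad 0\le \langle p, m_d(k)\rangle\le 1 \text{ for each } k\in\{2,\dots,b-1\},\qquad \langle p, m_d(b)\rangle=\tau, \] where $m_d(t):=(t,t^2,\dots,t^d)\in\mathbb{R}^d$ and $\langle\cdot,\cdot\rangle$ is the standard inner product.
   Context: $\deg(f)$ is the degree of the unique multilinear real polynomial agreeing with $f$ on $\{0,1\}^n$. For $S\subseteq[n]$, $x^S$ is $x$ with bits in $S$ flipped. $\mathrm{bs}_x(f)$ is the maximum $k$ such that there exist pairwise disjoint $B_1,\dots,B_k\subseteq[n]$ with $f(x)\ne f(x^{B_i})$ for all $i$, and $\mathrm{bs}(f)=\max_x\mathrm{bs}_x(f)$. -}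

module Defs where

open import Data.Bool using (Bool; true; false; _xor_)
open import Data.Nat as ℕ using (ℕ; zero; suc; _≤_; _<_; _^_)
open import Data.Integer using (+_)
open import Data.Rational using (ℚ; 0ℚ; 1ℚ; _+_; _*_; _/_)
open import Data.Fin using (Fin; zero; suc; toℕ)
open import Data.Fin.Subset using (Subset; _∩_; ⊥; ∣_∣)
open import Data.Vec using (Vec; []; _∷_; zipWith; lookup)
open import Data.List using (List; []; _∷_; map; _++_)
open import Data.Product using (Σ; ∃; _×_; _,_)
open import Relation.Binary.PropositionalEquality using (_≡_; _≢_)

-- points of the Boolean cube {0,1}^n (true = 1)
Cube : ℕ → Set
Cube n = Vec Bool n

BoolFun : ℕ → Set
BoolFun n = Cube n → Bool

toℚ : Bool → ℚ
toℚ true  = 1ℚ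
toℚ false = 0ℚ

-- list of all points of {0,1}^n (equivalently, all subsets of [n])
allVecs : (n : ℕ) → List (Vec Bool n)
allVecs zero    = [] ∷ []
allVecs (suc n) = map (true ∷_) (allVecs n) ++ map (false ∷_) (allVecs n)

sumℚ : List ℚ → ℚ
sumℚ []       = 0ℚ
sumℚ (q ∷ qs) = q + sumℚ qs

monomial : {n : ℕ} → Subset n → Cube n → ℚ
monomial []            []      = 1ℚ
monomial (false ∷ S)   (_ ∷ x) = monomial S x
monomial (true ∷ S)    (b ∷ x) = toℚ b * monomial S x

Multilinear : ℕ → Set
Multilinear n = Subset n → ℚ

eval : {n : ℕ} → Multilinear n → Cube n → ℚ
eval {n} c x = sumℚ (map (λ S → c S * monomial S x) (allVecs n))

Represents : {n : ℕ} → Multilinear n → BoolFun n → Set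
Represents c f = ∀ x → eval c x ≡ toℚ (f x)

PolyDegree : {n : ℕ} → Multilinear n → ℕ → Set
PolyDegree c d = (∀ S → c S ≢ 0ℚ → ∣ S ∣ ≤ d) × (∃ λ S → ∣ S ∣ ≡ d × c S ≢ 0ℚ)

-- deg(f) = d : the (unique) multilinear polynomial agreeing with f has degree d
Degree : {n : ℕ} → BoolFun n → ℕ → Set
Degree f d = ∃ λ c → Represents c f × PolyDegree c d

flip : {n : ℕ} → Cube n → Subset n → Cube n
flip x S = zipWith _xor_ x S

HasBlocks : {n : ℕ} → BoolFun n → Cube n → ℕ → Set
HasBlocks {n} f x k =
  Σ (Fin k → Subset n) λ B →
    (∀ i j → i ≢ j → B i ∩ B j ≡ ⊥) × (∀ i → f x ≢ f (flip x (B i)))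

BlockSensitivity : {n : ℕ} → BoolFun n → ℕ → Set
BlockSensitivity f b = (∃ λ x → HasBlocks f x b) × (∀ x k → HasBlocks f x k → k ≤ b)

inner : {d : ℕ} → (Fin d → ℚ) → (Fin d → ℚ) → ℚ
inner {zero}  p q = 0ℚ
inner {suc d} p q = p zero * q zero + inner (λ i → p (suc i)) (λ i → q (suc i))

m : (d : ℕ) → ℕ → Fin d → ℚ
m d t i = (+ (t ^ suc (toℕ i))) / 1

module Submission where

-- Fix x₀ with b disjoint sensitive blocks B₁ … B_b and restrict f to the subcube they span:
-- G(y) = f(x₀) ⊕ f(x₀ flipped on ⋃_{y_j = 1} B_j) is a function on {0,1}^b of degree ≤ d.
-- Symmetrising (Minsky–Papert), Σ_{|y| = k} G(y) = C(b,k) · Q(k) for a polynomial Q of degree ≤ d,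
-- and Q(0) = G(0) = 0, so Q(k) = ⟨p, m_d(k)⟩ for some p. Each block being sensitive gives Q(1) = 1,
-- 0 ≤ G ≤ 1 gives 0 ≤ Q(k) ≤ 1, and Q(b) = G(1,…,1) ∈ {0,1}. The polynomial Q is computed in the
-- Newton basis k ↦ C(k,i), in which symmetrisation becomes a recurrence in b.

open import Defs
open import Data.Bool using (Bool; true; false; _xor_; not; _∧_; _∨_)
open import Data.Bool.Properties using (xor-same; ¬-not; xor-inverseˡ)
open import Data.Fin using (Fin; zero; suc; toℕ; inject₁)
open import Data.Fin.Properties using (toℕ-inject₁; suc-injective)
open import Data.Fin.Subset using (Subset; _∩_; ⊥; ∣_∣)
open import Data.Integer using (+_) renaming (_+_ to _+ℤ_)
import Data.Integer.Properties as ℤ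
open import Data.List using (List; []; _∷_)
import Data.List as List
open import Data.Nat as ℕ using (ℕ; zero; suc; _^_; _≤_; _<_; z≤n; s≤s)
import Data.Nat.Properties as ℕ
open import Data.Nat.Combinatorics using (_C_; nCk+nC[k+1]≡[n+1]C[k+1]; nC1≡n; nCn≡1; k>n⇒nCk≡0)
open import Data.Nat.Coprimality using (1-coprimeTo) renaming (sym to coprime-sym)
import Data.Nat.Tactic.RingSolver as ℕ-Solver
open import Data.Product using (Σ; ∃; _×_; _,_; proj₁; proj₂)
open import Data.Rational using (ℚ; 0ℚ; 1ℚ; _+_; _*_; _-_; -_; 1/_; mkℚ; _/_; Positive; _≟_)
  renaming (_≤_ to _≤ℚ_)
open import Data.Rational.Properties
  using (+-*-commutativeRing; /-cong; normalize-coprime; ≤-refl; ≤-reflexive; ≤-antisym; +-mono-≤;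
         nonNegative⁻¹; pos⇒nonZero; *-cancelˡ-≤-pos; *-inverseˡ; +-inverseʳ; +-identityˡ; +-identityʳ;
         +-comm; +-assoc; *-zeroˡ; *-zeroʳ; *-identityˡ; *-identityʳ; *-assoc)
open import Data.Unit using (⊤; tt)
open import Data.Vec using (Vec; []; _∷_; zipWith; map; replicate; head; tail)
open import Function using (_∘_)
open import Relation.Binary.PropositionalEquality
open import Relation.Nullary using (yes; no)
open import Relation.Nullary.Decidable using (dec⇒maybe)
open import Tactic.RingSolver using (solve-∀)
import Tactic.RingSolver.Core.AlmostCommutativeRing as ACR

ℚ-ring : ACR.AlmostCommutativeRing _ _
ℚ-ring = ACR.fromCommutativeRing +-*-commutativeRing (λ x → dec⇒maybe (0ℚ ≟ x))

fromℕ : ℕ → ℚ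
fromℕ n = + n / 1

fromℕ≡mkℚ : ∀ n → fromℕ n ≡ mkℚ (+ n) 0 (coprime-sym (1-coprimeTo n))
fromℕ≡mkℚ n = normalize-coprime _

fromℕ-+ : ∀ m n → fromℕ (m ℕ.+ n) ≡ fromℕ m + fromℕ n
fromℕ-+ m n rewrite fromℕ≡mkℚ m | fromℕ≡mkℚ n =
  /-cong {+ (m ℕ.+ n)} {1} (sym (cong₂ _+ℤ_ (ℤ.*-identityʳ (+ m)) (ℤ.*-identityʳ (+ n)))) refl

fromℕ-* : ∀ m n → fromℕ (m ℕ.* n) ≡ fromℕ m * fromℕ n
fromℕ-* m n rewrite fromℕ≡mkℚ m | fromℕ≡mkℚ n = /-cong {+ (m ℕ.* n)} {1} (ℤ.pos-* m n) refl

fromℕ-positive : ∀ n .{{_ : ℕ.NonZero n}} → Positive (fromℕ n)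
fromℕ-positive (suc n) = subst Positive (sym (fromℕ≡mkℚ (suc n))) _

1/[1+_] : ℕ → ℚ
1/[1+ n ] = (1/ fromℕ (suc n)) {{pos⇒nonZero (fromℕ (suc n)) {{fromℕ-positive (suc n)}}}}

1/[1+n]*[1+n]≡1 : ∀ n → 1/[1+ n ] * fromℕ (suc n) ≡ 1ℚ
1/[1+n]*[1+n]≡1 n = *-inverseˡ (fromℕ (suc n)) {{pos⇒nonZero (fromℕ (suc n)) {{fromℕ-positive (suc n)}}}}

*-cancelˡ-≡-pos : ∀ r .{{_ : Positive r}} {p q} → r * p ≡ r * q → p ≡ q
*-cancelˡ-≡-pos r eq =
  ≤-antisym (*-cancelˡ-≤-pos r (≤-reflexive eq)) (*-cancelˡ-≤-pos r (≤-reflexive (sym eq)))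

*-cancelˡ-∈[0,1] : ∀ c .{{_ : Positive c}} {q} → 0ℚ ≤ℚ c * q × c * q ≤ℚ c → 0ℚ ≤ℚ q × q ≤ℚ 1ℚ
*-cancelˡ-∈[0,1] c {q} (0≤cq , cq≤c) =
  *-cancelˡ-≤-pos c (subst (_≤ℚ c * q) (sym (*-zeroʳ c)) 0≤cq) ,
  *-cancelˡ-≤-pos c (subst (c * q ≤ℚ_) (sym (*-identityʳ c)) cq≤c)

-- Binomial coefficients

0C[1+k]≡0 : ∀ k → 0 C suc k ≡ 0
0C[1+k]≡0 k = k>n⇒nCk≡0 {0} {suc k} (s≤s z≤n)

nCk>0 : ∀ {n k} → k ≤ n → 0 < n C k
nCk>0 {k = zero} _ = s≤s z≤n
nCk>0 {suc n} {suc k} (s≤s k≤n) =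
  subst (0 <_) (nCk+nC[k+1]≡[n+1]C[k+1] n k) (ℕ.<-≤-trans (nCk>0 k≤n) (ℕ.m≤m+n _ _))

[1+k]*[1+n]C[1+k]≡[1+n]*nCk : ∀ n k → suc k ℕ.* (suc n C suc k) ≡ suc n ℕ.* (n C k)
[1+k]*[1+n]C[1+k]≡[1+n]*nCk zero    zero    = refl
[1+k]*[1+n]C[1+k]≡[1+n]*nCk zero    (suc k) rewrite k>n⇒nCk≡0 {1} {suc (suc k)} (s≤s (s≤s z≤n)) | 0C[1+k]≡0 k =
  ℕ.*-zeroʳ (suc (suc k))
[1+k]*[1+n]C[1+k]≡[1+n]*nCk (suc n) zero    =
  trans (ℕ.+-identityʳ _) (trans (nC1≡n (suc (suc n))) (sym (ℕ.*-identityʳ (suc (suc n)))))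
[1+k]*[1+n]C[1+k]≡[1+n]*nCk (suc n) (suc k) = begin
  suc (suc k) ℕ.* (suc (suc n) C suc (suc k))   ≡⟨ cong (suc (suc k) ℕ.*_) (sym (nCk+nC[k+1]≡[n+1]C[k+1] (suc n) (suc k))) ⟩
  suc (suc k) ℕ.* (X ℕ.+ Y)                     ≡⟨ split k X Y ⟩
  suc k ℕ.* X ℕ.+ X ℕ.+ suc (suc k) ℕ.* Y
    ≡⟨ cong₂ (λ u v → u ℕ.+ X ℕ.+ v) ([1+k]*[1+n]C[1+k]≡[1+n]*nCk n k) ([1+k]*[1+n]C[1+k]≡[1+n]*nCk n (suc k)) ⟩
  suc n ℕ.* (n C k) ℕ.+ X ℕ.+ suc n ℕ.* (n C suc k) ≡⟨ regroup n (n C k) (n C suc k) X ⟩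
  suc n ℕ.* (n C k ℕ.+ n C suc k) ℕ.+ X        ≡⟨ cong (λ u → suc n ℕ.* u ℕ.+ X) (nCk+nC[k+1]≡[n+1]C[k+1] n k) ⟩
  suc n ℕ.* X ℕ.+ X                            ≡⟨ ℕ.+-comm (suc n ℕ.* X) X ⟩
  suc (suc n) ℕ.* X                            ∎
  where
  open ≡-Reasoning
  X Y : ℕ
  X = suc n C suc k
  Y = suc n C suc (suc k)
  split : ∀ k x y → suc (suc k) ℕ.* (x ℕ.+ y) ≡ suc k ℕ.* x ℕ.+ x ℕ.+ suc (suc k) ℕ.* y
  split = ℕ-Solver.solve-∀
  regroup : ∀ n a c x → suc n ℕ.* a ℕ.+ x ℕ.+ suc n ℕ.* c ≡ suc n ℕ.* (a ℕ.+ c) ℕ.+ x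
  regroup = ℕ-Solver.solve-∀

[1+t]*kC[1+t]+t*kCt≡k*kCt : ∀ k t → suc t ℕ.* (k C suc t) ℕ.+ t ℕ.* (k C t) ≡ k ℕ.* (k C t)
[1+t]*kC[1+t]+t*kCt≡k*kCt zero    zero    = refl
[1+t]*kC[1+t]+t*kCt≡k*kCt zero    (suc t) rewrite 0C[1+k]≡0 t | 0C[1+k]≡0 (suc t) =
  cong₂ ℕ._+_ (ℕ.*-zeroʳ (suc (suc t))) (ℕ.*-zeroʳ (suc t))
[1+t]*kC[1+t]+t*kCt≡k*kCt (suc k) zero    =
  trans (ℕ.+-identityʳ _) (trans (ℕ.+-identityʳ _) (trans (nC1≡n (suc k)) (sym (ℕ.*-identityʳ (suc k)))))
[1+t]*kC[1+t]+t*kCt≡k*kCt (suc k) (suc s) = begin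
  suc (suc s) ℕ.* (suc k C suc (suc s)) ℕ.+ suc s ℕ.* (suc k C suc s)
    ≡⟨ cong₂ ℕ._+_ ([1+k]*[1+n]C[1+k]≡[1+n]*nCk k (suc s)) ([1+k]*[1+n]C[1+k]≡[1+n]*nCk k s) ⟩
  suc k ℕ.* (k C suc s) ℕ.+ suc k ℕ.* (k C s)
    ≡⟨ sym (ℕ.*-distribˡ-+ (suc k) (k C suc s) (k C s)) ⟩
  suc k ℕ.* (k C suc s ℕ.+ k C s)
    ≡⟨ cong (suc k ℕ.*_) (trans (ℕ.+-comm (k C suc s) (k C s)) (nCk+nC[k+1]≡[n+1]C[k+1] k s)) ⟩
  suc k ℕ.* (suc k C suc s) ∎
  where open ≡-Reasoning

-- Opaque so that Agda never tries to normalise n C k, which is defined by factorial division.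
opaque
  choose : ℕ → ℕ → ℚ
  choose n k = fromℕ (n C k)

  choose-0 : ∀ n → choose n 0 ≡ 1ℚ
  choose-0 n = refl

  choose-0-suc : ∀ k → choose 0 (suc k) ≡ 0ℚ
  choose-0-suc k = cong fromℕ (0C[1+k]≡0 k)

  choose-1 : ∀ n → choose n 1 ≡ fromℕ n
  choose-1 n = cong fromℕ (nC1≡n n)

  choose-diag : ∀ n → choose n n ≡ 1ℚ
  choose-diag n = cong fromℕ (nCn≡1 n)

  choose-positive : ∀ {n k} → k ≤ n → Positive (choose n k)
  choose-positive {n} {k} k≤n = fromℕ-positive (n C k) {{ℕ.>-nonZero (nCk>0 k≤n)}}

  choose-pascal : ∀ n k → choose (suc n) (suc k) ≡ choose n k + choose n (suc k)
  choose-pascal n k = trans (cong fromℕ (sym (nCk+nC[k+1]≡[n+1]C[k+1] n k))) (fromℕ-+ (n C k) (n C suc k))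

  choose-absorb : ∀ n k → choose (suc n) (suc k) * fromℕ (suc k) ≡ fromℕ (suc n) * choose n k
  choose-absorb n k = begin
    choose (suc n) (suc k) * fromℕ (suc k)       ≡⟨ sym (fromℕ-* (suc n C suc k) (suc k)) ⟩
    fromℕ ((suc n C suc k) ℕ.* suc k)            ≡⟨ cong fromℕ (ℕ.*-comm (suc n C suc k) (suc k)) ⟩
    fromℕ (suc k ℕ.* (suc n C suc k))            ≡⟨ cong fromℕ ([1+k]*[1+n]C[1+k]≡[1+n]*nCk n k) ⟩
    fromℕ (suc n ℕ.* (n C k))                    ≡⟨ fromℕ-* (suc n) (n C k) ⟩
    fromℕ (suc n) * choose n k                   ∎
    where open ≡-Reasoning

  choose-recurrence : ∀ k t → fromℕ (suc (suc t)) * choose k (suc (suc t)) ≡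
                              fromℕ k * choose k (suc t) - fromℕ (suc t) * choose k (suc t)
  choose-recurrence k t = begin
    X                ≡⟨ cancel X Y ⟩
    (X + Y) - Y      ≡⟨ cong (_- Y) X+Y≡Z ⟩
    Z - Y            ∎
    where
    open ≡-Reasoning
    X Y Z : ℚ
    X = fromℕ (suc (suc t)) * choose k (suc (suc t))
    Y = fromℕ (suc t) * choose k (suc t)
    Z = fromℕ k * choose k (suc t)
    cancel : ∀ x y → x ≡ (x + y) - y
    cancel = solve-∀ ℚ-ring
    X+Y≡Z : X + Y ≡ Z
    X+Y≡Z = begin
      X + Y
        ≡⟨ sym (cong₂ _+_ (fromℕ-* (suc (suc t)) (k C suc (suc t))) (fromℕ-* (suc t) (k C suc t))) ⟩
      fromℕ (suc (suc t) ℕ.* (k C suc (suc t))) + fromℕ (suc t ℕ.* (k C suc t))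
        ≡⟨ sym (fromℕ-+ (suc (suc t) ℕ.* (k C suc (suc t))) (suc t ℕ.* (k C suc t))) ⟩
      fromℕ (suc (suc t) ℕ.* (k C suc (suc t)) ℕ.+ suc t ℕ.* (k C suc t))
        ≡⟨ cong fromℕ ([1+t]*kC[1+t]+t*kCt≡k*kCt k (suc t)) ⟩
      fromℕ (k ℕ.* (k C suc t))
        ≡⟨ fromℕ-* k (k C suc t) ⟩
      Z ∎

-- Degree of functions on the cube

CubeFn : ℕ → Set
CubeFn b = Cube b → ℚ

restrict₀ restrict₁ ∂ : ∀ {b} → CubeFn (suc b) → CubeFn b
restrict₀ F y = F (false ∷ y)
restrict₁ F y = F (true ∷ y)
∂ F y = F (true ∷ y) - F (false ∷ y)

-- Degree below r as a multilinear polynomial, read off from F = F₀ + x₁ · ∂F.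
Deg< : ∀ {b} → ℕ → CubeFn b → Set
Deg< zero F = ∀ y → F y ≡ 0ℚ
Deg< {zero}  (suc r) F = ⊤
Deg< {suc b} (suc r) F = Deg< (suc r) (restrict₀ F) × Deg< r (∂ F)

Deg<-cong : ∀ {b} r {F H : CubeFn b} → (∀ y → F y ≡ H y) → Deg< r F → Deg< r H
Deg<-cong zero    F≗H F<r y = trans (sym (F≗H y)) (F<r y)
Deg<-cong {zero}  (suc r) F≗H F<r = tt
Deg<-cong {suc b} (suc r) F≗H (F₀<r , ∂F<r) =
  Deg<-cong (suc r) (λ y → F≗H (false ∷ y)) F₀<r ,
  Deg<-cong r (λ y → cong₂ _-_ (F≗H (true ∷ y)) (F≗H (false ∷ y))) ∂F<r

Deg<-zero : ∀ {b} r {F : CubeFn b} → (∀ y → F y ≡ 0ℚ) → Deg< r F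
Deg<-zero zero    F≗0 = F≗0
Deg<-zero {zero}  (suc r) F≗0 = tt
Deg<-zero {suc b} (suc r) F≗0 =
  Deg<-zero (suc r) (λ y → F≗0 (false ∷ y)) ,
  Deg<-zero r (λ y → cong₂ _-_ (F≗0 (true ∷ y)) (F≗0 (false ∷ y)))

Deg<-suc : ∀ {b} r {F : CubeFn b} → Deg< r F → Deg< (suc r) F
Deg<-suc zero    F≗0 = Deg<-zero 1 F≗0
Deg<-suc {zero}  (suc r) _ = tt
Deg<-suc {suc b} (suc r) (F₀<r , ∂F<r) = Deg<-suc (suc r) F₀<r , Deg<-suc r ∂F<r

Deg<-mono : ∀ {b r s} {F : CubeFn b} → r ≤ s → Deg< r F → Deg< s F
Deg<-mono {r = r} r≤s F<r with ℕ.≤⇒≤′ r≤s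
... | ℕ.≤′-refl       = F<r
... | ℕ.≤′-step r≤′s  = Deg<-suc _ (Deg<-mono (ℕ.≤′⇒≤ r≤′s) F<r)

Deg<-const : ∀ {b} (c : ℚ) → Deg< {b} 1 (λ _ → c)
Deg<-const {zero}  c = tt
Deg<-const {suc b} c = Deg<-const c , λ _ → +-inverseʳ c

Deg<-+ : ∀ {b} r {F H : CubeFn b} → Deg< r F → Deg< r H → Deg< r (λ y → F y + H y)
Deg<-+ zero    F<r H<r y = trans (cong₂ _+_ (F<r y) (H<r y)) (+-identityʳ 0ℚ)
Deg<-+ {zero}  (suc r) _ _ = tt
Deg<-+ {suc b} (suc r) {F} {H} (F₀<r , ∂F<r) (H₀<r , ∂H<r) =
  Deg<-+ (suc r) F₀<r H₀<r ,
  Deg<-cong r (λ y → ∂-+ (F (true ∷ y)) (F (false ∷ y)) (H (true ∷ y)) (H (false ∷ y))) (Deg<-+ r ∂F<r ∂H<r)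
  where
  ∂-+ : ∀ a b c d → (a - b) + (c - d) ≡ (a + c) - (b + d)
  ∂-+ = solve-∀ ℚ-ring

Deg<-scale : ∀ {b} r (c : ℚ) {F : CubeFn b} → Deg< r F → Deg< r (λ y → c * F y)
Deg<-scale zero    c F<r y = trans (cong (c *_) (F<r y)) (*-zeroʳ c)
Deg<-scale {zero}  (suc r) c _ = tt
Deg<-scale {suc b} (suc r) c {F} (F₀<r , ∂F<r) =
  Deg<-scale (suc r) c F₀<r ,
  Deg<-cong r (λ y → *-distribˡ-- c (F (true ∷ y)) (F (false ∷ y))) (Deg<-scale r c ∂F<r)
  where
  *-distribˡ-- : ∀ c a b → c * (a - b) ≡ c * a - c * b
  *-distribˡ-- = solve-∀ ℚ-ring

Deg<-restrict₁ : ∀ {b} r {F : CubeFn (suc b)} → Deg< r F → Deg< r (restrict₁ F)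
Deg<-restrict₁ zero    F≗0 y = F≗0 (true ∷ y)
Deg<-restrict₁ (suc r) {F} (F₀<r , ∂F<r) =
  Deg<-cong (suc r) (λ y → F₀+∂F≡F₁ (F (true ∷ y)) (F (false ∷ y))) (Deg<-+ (suc r) F₀<r (Deg<-suc r ∂F<r))
  where
  F₀+∂F≡F₁ : ∀ a b → b + (a - b) ≡ a
  F₀+∂F≡F₁ = solve-∀ ℚ-ring

Deg<-* : ∀ {b} r s {F H : CubeFn b} →
         Deg< (suc r) F → Deg< (suc s) H → Deg< (suc (r ℕ.+ s)) (λ y → F y * H y)
Deg<-* {zero}  r s _ _ = tt
Deg<-* {suc b} r s {F} {H} (F₀<r , ∂F<r) (H₀<s , ∂H<s) =
  Deg<-* r s F₀<r H₀<s ,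
  Deg<-cong (r ℕ.+ s) (λ y → sym (product-rule (F (true ∷ y)) (F (false ∷ y)) (H (true ∷ y)) (H (false ∷ y))))
            (Deg<-+ (r ℕ.+ s) (∂F*H₁ r ∂F<r) (F₀*∂H s ∂H<s))
  where
  product-rule : ∀ f₁ f₀ h₁ h₀ → f₁ * h₁ - f₀ * h₀ ≡ (f₁ - f₀) * h₁ + f₀ * (h₁ - h₀)
  product-rule = solve-∀ ℚ-ring
  ∂F*H₁ : ∀ r → Deg< r (∂ F) → Deg< (r ℕ.+ s) (λ y → ∂ F y * H (true ∷ y))
  ∂F*H₁ zero    ∂F≗0 = Deg<-zero s (λ y → trans (cong (_* H (true ∷ y)) (∂F≗0 y)) (*-zeroˡ (H (true ∷ y))))
  ∂F*H₁ (suc r) ∂F<r = Deg<-* r s ∂F<r (Deg<-restrict₁ (suc s) {H} (H₀<s , ∂H<s))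
  F₀*∂H : ∀ s → Deg< s (∂ H) → Deg< (r ℕ.+ s) (λ y → F (false ∷ y) * ∂ H y)
  F₀*∂H zero    ∂H≗0 =
    Deg<-zero (r ℕ.+ 0) (λ y → trans (cong (F (false ∷ y) *_) (∂H≗0 y)) (*-zeroʳ (F (false ∷ y))))
  F₀*∂H (suc s) ∂H<s =
    subst (λ n → Deg< n (λ y → F (false ∷ y) * ∂ H y)) (sym (ℕ.+-suc r s)) (Deg<-* r s F₀<r ∂H<s)

-- Level sums and symmetrisation

levelSum : ∀ {b} → CubeFn b → ℕ → ℚ
levelSum {zero}  F zero    = F []
levelSum {zero}  F (suc k) = 0ℚ
levelSum {suc b} F zero    = levelSum (restrict₀ F) zero
levelSum {suc b} F (suc k) = levelSum (restrict₀ F) (suc k) + levelSum (restrict₁ F) k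

levelSum-cong : ∀ {b} {F H : CubeFn b} → (∀ y → F y ≡ H y) → ∀ k → levelSum F k ≡ levelSum H k
levelSum-cong {zero}  F≗H zero    = F≗H []
levelSum-cong {zero}  F≗H (suc k) = refl
levelSum-cong {suc b} F≗H zero    = levelSum-cong (λ y → F≗H (false ∷ y)) zero
levelSum-cong {suc b} F≗H (suc k) =
  cong₂ _+_ (levelSum-cong (λ y → F≗H (false ∷ y)) (suc k)) (levelSum-cong (λ y → F≗H (true ∷ y)) k)

levelSum-+ : ∀ {b} (F H : CubeFn b) k → levelSum (λ y → F y + H y) k ≡ levelSum F k + levelSum H k
levelSum-+ {zero}  F H zero    = refl
levelSum-+ {zero}  F H (suc k) = sym (+-identityʳ 0ℚ)
levelSum-+ {suc b} F H zero    = levelSum-+ (restrict₀ F) (restrict₀ H) zero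
levelSum-+ {suc b} F H (suc k) =
  trans (cong₂ _+_ (levelSum-+ (restrict₀ F) (restrict₀ H) (suc k)) (levelSum-+ (restrict₁ F) (restrict₁ H) k))
        (interchange (levelSum (restrict₀ F) (suc k)) (levelSum (restrict₀ H) (suc k))
                     (levelSum (restrict₁ F) k) (levelSum (restrict₁ H) k))
  where
  interchange : ∀ a b c d → (a + b) + (c + d) ≡ (a + c) + (b + d)
  interchange = solve-∀ ℚ-ring

levelSum-zero : ∀ {b} {F : CubeFn b} → (∀ y → F y ≡ 0ℚ) → ∀ k → levelSum F k ≡ 0ℚ
levelSum-zero {zero}  F≗0 zero    = F≗0 []
levelSum-zero {zero}  F≗0 (suc k) = refl
levelSum-zero {suc b} F≗0 zero    = levelSum-zero (λ y → F≗0 (false ∷ y)) zero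
levelSum-zero {suc b} F≗0 (suc k) =
  trans (cong₂ _+_ (levelSum-zero (λ y → F≗0 (false ∷ y)) (suc k)) (levelSum-zero (λ y → F≗0 (true ∷ y)) k))
        (+-identityʳ 0ℚ)

levelSum-0 : ∀ {b} (F : CubeFn b) → levelSum F 0 ≡ F (replicate b false)
levelSum-0 {zero}  F = refl
levelSum-0 {suc b} F = levelSum-0 (restrict₀ F)

unitVector : ∀ {b} → Fin b → Cube b
unitVector {suc b} zero    = true ∷ replicate b false
unitVector {suc b} (suc j) = false ∷ unitVector j

levelSum-1 : ∀ {b} (F : CubeFn b) → (∀ j → F (unitVector j) ≡ 1ℚ) → levelSum F 1 ≡ fromℕ b
levelSum-1 {zero}  F _     = refl
levelSum-1 {suc b} F F[e]≡1 = begin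
  levelSum (restrict₀ F) 1 + levelSum (restrict₁ F) 0
    ≡⟨ cong₂ _+_ (levelSum-1 (restrict₀ F) (λ j → F[e]≡1 (suc j))) (trans (levelSum-0 (restrict₁ F)) (F[e]≡1 zero)) ⟩
  fromℕ b + 1ℚ
    ≡⟨ +-comm (fromℕ b) 1ℚ ⟩
  1ℚ + fromℕ b
    ≡⟨ sym (fromℕ-+ 1 b) ⟩
  fromℕ (suc b) ∎
  where open ≡-Reasoning

levelSum-> : ∀ {b} (F : CubeFn b) {k} → b < k → levelSum F k ≡ 0ℚ
levelSum-> {zero}  F {suc k} _         = refl
levelSum-> {suc b} F {suc k} (s≤s b<k) =
  trans (cong₂ _+_ (levelSum-> (restrict₀ F) (ℕ.m≤n⇒m≤1+n b<k)) (levelSum-> (restrict₁ F) b<k)) (+-identityʳ 0ℚ)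

levelSum-top : ∀ {b} (F : CubeFn b) → levelSum F b ≡ F (replicate b true)
levelSum-top {zero}  F = refl
levelSum-top {suc b} F =
  trans (cong₂ _+_ (levelSum-> (restrict₀ F) ℕ.≤-refl) (levelSum-top (restrict₁ F))) (+-identityˡ _)

levelSum-bounded : ∀ {b} (F : CubeFn b) → (∀ y → 0ℚ ≤ℚ F y × F y ≤ℚ 1ℚ) →
                   ∀ k → 0ℚ ≤ℚ levelSum F k × levelSum F k ≤ℚ choose b k
levelSum-bounded {zero}  F F∈[0,1] zero    = proj₁ (F∈[0,1] []) , subst (F [] ≤ℚ_) (sym (choose-0 0)) (proj₂ (F∈[0,1] []))
levelSum-bounded {zero}  F F∈[0,1] (suc k) = ≤-refl , ≤-reflexive (sym (choose-0-suc k))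
levelSum-bounded {suc b} F F∈[0,1] zero    =
  subst (λ c → 0ℚ ≤ℚ levelSum F 0 × levelSum F 0 ≤ℚ c) (trans (choose-0 b) (sym (choose-0 (suc b))))
        (levelSum-bounded (restrict₀ F) (λ y → F∈[0,1] (false ∷ y)) zero)
levelSum-bounded {suc b} F F∈[0,1] (suc k)
  with levelSum-bounded (restrict₀ F) (λ y → F∈[0,1] (false ∷ y)) (suc k)
     | levelSum-bounded (restrict₁ F) (λ y → F∈[0,1] (true ∷ y)) k
... | 0≤L₀ , L₀≤C | 0≤L₁ , L₁≤C =
  subst (_≤ℚ L) (+-identityʳ 0ℚ) (+-mono-≤ 0≤L₀ 0≤L₁) ,
  subst (L ≤ℚ_) (trans (+-comm (choose b (suc k)) (choose b k)) (sym (choose-pascal b k))) (+-mono-≤ L₀≤C L₁≤C)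
  where
  L : ℚ
  L = levelSum F (suc k)

newton : ∀ {r} → ℕ → Vec ℚ r → ℕ → ℚ
newton o []       k = 0ℚ
newton o (β ∷ βs) k = β * choose k o + newton (suc o) βs k

newton-0 : ∀ {r} o (βs : Vec ℚ r) → newton (suc o) βs 0 ≡ 0ℚ
newton-0 o []       = refl
newton-0 o (β ∷ βs) rewrite newton-0 (suc o) βs | choose-0-suc o = trans (+-identityʳ (β * 0ℚ)) (*-zeroʳ β)

newton-pascal : ∀ {r} o (βs : Vec ℚ r) k → newton (suc o) βs (suc k) ≡ newton (suc o) βs k + newton o βs k
newton-pascal o []       k = sym (+-identityʳ 0ℚ)
newton-pascal o (β ∷ βs) k rewrite choose-pascal k o | newton-pascal (suc o) βs k =
  distrib β (choose k o) (choose k (suc o)) (newton (suc (suc o)) βs k) (newton (suc o) βs k)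
  where
  distrib : ∀ β c c′ e e′ → β * (c + c′) + (e + e′) ≡ (β * c′ + e) + (β * c + e′)
  distrib = solve-∀ ℚ-ring

newton-Δ : ∀ {r} β (βs : Vec ℚ r) k → newton 0 (β ∷ βs) (suc k) ≡ newton 0 (β ∷ βs) k + newton 0 βs k
newton-Δ β βs k = begin
  β * choose (suc k) 0 + newton 1 βs (suc k)           ≡⟨ cong₂ (λ c e → β * c + e) (trans (choose-0 (suc k)) (sym (choose-0 k)))
                                                                                    (newton-pascal 0 βs k) ⟩
  β * choose k 0 + (newton 1 βs k + newton 0 βs k)     ≡⟨ sym (+-assoc (β * choose k 0) (newton 1 βs k) (newton 0 βs k)) ⟩
  β * choose k 0 + newton 1 βs k + newton 0 βs k       ∎
  where open ≡-Reasoning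

newton-+ : ∀ {r} o (βs γs : Vec ℚ r) k → newton o (zipWith _+_ βs γs) k ≡ newton o βs k + newton o γs k
newton-+ o []       []       k = sym (+-identityʳ 0ℚ)
newton-+ o (β ∷ βs) (γ ∷ γs) k rewrite newton-+ (suc o) βs γs k =
  distrib β γ (choose k o) (newton (suc o) βs k) (newton (suc o) γs k)
  where
  distrib : ∀ β γ c e e′ → (β + γ) * c + (e + e′) ≡ (β * c + e) + (γ * c + e′)
  distrib = solve-∀ ℚ-ring

newton-- : ∀ {r} o (βs γs : Vec ℚ r) k → newton o (zipWith _-_ βs γs) k ≡ newton o βs k - newton o γs k
newton-- o []       []       k = refl
newton-- o (β ∷ βs) (γ ∷ γs) k rewrite newton-- (suc o) βs γs k =
  distrib β γ (choose k o) (newton (suc o) βs k) (newton (suc o) γs k)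
  where
  distrib : ∀ β γ c e e′ → (β - γ) * c + (e - e′) ≡ (β * c + e) - (γ * c + e′)
  distrib = solve-∀ ℚ-ring

newton-scale : ∀ {r} o (a : ℚ) (βs : Vec ℚ r) k → newton o (map (a *_) βs) k ≡ a * newton o βs k
newton-scale o a []       k = sym (*-zeroʳ a)
newton-scale o a (β ∷ βs) k rewrite newton-scale (suc o) a βs k =
  distrib a β (choose k o) (newton (suc o) βs k)
  where
  distrib : ∀ a β c e → a * β * c + a * e ≡ a * (β * c + e)
  distrib = solve-∀ ℚ-ring

scaleByIndex : ∀ {r} → ℕ → Vec ℚ r → Vec ℚ r
scaleByIndex o []       = []
scaleByIndex o (β ∷ βs) = fromℕ o * β ∷ scaleByIndex (suc o) βs

newton-absorb : ∀ {r} o (βs : Vec ℚ r) k →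
                newton (suc o) (scaleByIndex (suc o) βs) (suc k) ≡ fromℕ (suc k) * newton o βs k
newton-absorb o []       k = sym (*-zeroʳ (fromℕ (suc k)))
newton-absorb o (β ∷ βs) k rewrite newton-absorb (suc o) βs k = begin
  fromℕ (suc o) * β * choose (suc k) (suc o) + s * e ≡⟨ reorder (fromℕ (suc o)) β (choose (suc k) (suc o)) (s * e) ⟩
  β * (choose (suc k) (suc o) * fromℕ (suc o)) + s * e ≡⟨ cong (λ c → β * c + s * e) (choose-absorb k o) ⟩
  β * (s * choose k o) + s * e                        ≡⟨ factor β s (choose k o) e ⟩
  s * (β * choose k o + e)                            ∎
  where
  open ≡-Reasoning
  s e : ℚ
  s = fromℕ (suc k)
  e = newton (suc o) βs k
  reorder : ∀ a β c x → a * β * c + x ≡ β * (c * a) + x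
  reorder = solve-∀ ℚ-ring
  factor : ∀ β s c e → β * (s * c) + s * e ≡ s * (β * c + e)
  factor = solve-∀ ℚ-ring

newton-replicate-0 : ∀ r o k → newton o (replicate r 0ℚ) k ≡ 0ℚ
newton-replicate-0 zero    o k = refl
newton-replicate-0 (suc r) o k rewrite newton-replicate-0 r (suc o) k = trans (+-identityʳ _) (*-zeroˡ (choose k o))

choose-recombine : ∀ b k q δ q′ →
                   choose b (suc k) * (q + δ) + (choose b k * q + choose b k * q′) ≡
                   choose (suc b) (suc k) * ((q + δ) + 1/[1+ b ] * (fromℕ (suc k) * (q′ - δ)))
choose-recombine b k q δ q′ = sym (begin
  C′ * ((q + δ) + iv * (s * (q′ - δ)))
    ≡⟨ expand C′ q δ iv s q′ ⟩
  C′ * (q + δ) + (C′ * s) * (iv * (q′ - δ))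
    ≡⟨ cong (λ x → C′ * (q + δ) + x * (iv * (q′ - δ))) (choose-absorb b k) ⟩
  C′ * (q + δ) + (n * B) * (iv * (q′ - δ))
    ≡⟨ swap C′ (q + δ) n B iv (q′ - δ) ⟩
  C′ * (q + δ) + (iv * n) * (B * (q′ - δ))
    ≡⟨ cong (λ x → C′ * (q + δ) + x * (B * (q′ - δ))) (1/[1+n]*[1+n]≡1 b) ⟩
  C′ * (q + δ) + 1ℚ * (B * (q′ - δ))
    ≡⟨ cong (λ c → c * (q + δ) + 1ℚ * (B * (q′ - δ))) (choose-pascal b k) ⟩
  (B + A) * (q + δ) + 1ℚ * (B * (q′ - δ))
    ≡⟨ collect B A q δ q′ ⟩
  A * (q + δ) + (B * q + B * q′)                   ∎)
  where
  open ≡-Reasoning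
  A B C′ s n iv : ℚ
  A  = choose b (suc k)
  B  = choose b k
  C′ = choose (suc b) (suc k)
  s  = fromℕ (suc k)
  n  = fromℕ (suc b)
  iv = 1/[1+ b ]
  expand : ∀ C q δ iv s q′ → C * ((q + δ) + iv * (s * (q′ - δ))) ≡ C * (q + δ) + (C * s) * (iv * (q′ - δ))
  expand = solve-∀ ℚ-ring
  swap : ∀ C x n B iv y → C * x + (n * B) * (iv * y) ≡ C * x + (iv * n) * (B * y)
  swap = solve-∀ ℚ-ring
  collect : ∀ B A q δ q′ → (B + A) * (q + δ) + 1ℚ * (B * (q′ - δ)) ≡ A * (q + δ) + (B * q + B * q′)
  collect = solve-∀ ℚ-ring

-- With Q₀, Q∂ the Newton series of β and γ, the new series is
-- Q(k + 1) = Q₀(k + 1) + (k + 1)/(b + 1) · (Q∂(k) − ΔQ₀(k)): exactly what choose-recombine needs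
-- to turn the level sums of F₀ and ∂F into those of F = F₀ + x₁ · ∂F.
stepCoefficients : ∀ {r} → ℕ → Vec ℚ (suc r) → Vec ℚ r → Vec ℚ (suc r)
stepCoefficients b (β₀ ∷ βs) γs = β₀ ∷ zipWith _+_ βs (map (1/[1+ b ] *_) (scaleByIndex 1 (zipWith _-_ γs βs)))

newton-stepCoefficients-0 : ∀ {r} b (β : Vec ℚ (suc r)) γs → newton 0 (stepCoefficients b β γs) 0 ≡ newton 0 β 0
newton-stepCoefficients-0 b (β₀ ∷ βs) γs =
  cong (λ e → β₀ * choose 0 0 + e)
       (trans (newton-0 0 (zipWith _+_ βs (map (1/[1+ b ] *_) (scaleByIndex 1 (zipWith _-_ γs βs))))) (sym (newton-0 0 βs)))

newton-stepCoefficients-suc : ∀ {r} b β₀ (βs γs : Vec ℚ r) k →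
  newton 0 (stepCoefficients b (β₀ ∷ βs) γs) (suc k) ≡
  newton 0 (β₀ ∷ βs) (suc k) + 1/[1+ b ] * (fromℕ (suc k) * (newton 0 γs k - newton 0 βs k))
newton-stepCoefficients-suc {r} b β₀ βs γs k = begin
  β₀ * c + newton 1 (zipWith _+_ βs ws) (suc k)        ≡⟨ cong (λ e → β₀ * c + e) (newton-+ 1 βs ws (suc k)) ⟩
  β₀ * c + (newton 1 βs (suc k) + newton 1 ws (suc k)) ≡⟨ cong (λ e → β₀ * c + (newton 1 βs (suc k) + e)) ws-value ⟩
  β₀ * c + (newton 1 βs (suc k) + correction)          ≡⟨ sym (+-assoc (β₀ * c) (newton 1 βs (suc k)) correction) ⟩
  β₀ * c + newton 1 βs (suc k) + correction            ∎
  where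
  open ≡-Reasoning
  c correction : ℚ
  c = choose (suc k) 0
  correction = 1/[1+ b ] * (fromℕ (suc k) * (newton 0 γs k - newton 0 βs k))
  ws : Vec ℚ r
  ws = map (1/[1+ b ] *_) (scaleByIndex 1 (zipWith _-_ γs βs))
  ws-value : newton 1 ws (suc k) ≡ correction
  ws-value = trans (newton-scale 1 1/[1+ b ] (scaleByIndex 1 (zipWith _-_ γs βs)) (suc k))
                   (cong (1/[1+ b ] *_) (trans (newton-absorb 0 (zipWith _-_ γs βs) k)
                                               (cong (fromℕ (suc k) *_) (newton-- 0 γs βs k))))

symmetrization : ∀ {b} r (F : CubeFn b) → Deg< r F →
                 Σ (Vec ℚ r) λ β → ∀ k → levelSum F k ≡ choose b k * newton 0 β k
symmetrization zero F F≗0 = [] , λ k → trans (levelSum-zero F≗0 k) (sym (*-zeroʳ (choose _ k)))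
symmetrization {zero} (suc r) F _ = F [] ∷ replicate r 0ℚ , constant
  where
  N : ℕ → ℚ
  N = newton 0 (F [] ∷ replicate r 0ℚ)
  N≡F[] : ∀ k → N k ≡ F []
  N≡F[] k =
    trans (cong₂ (λ c e → F [] * c + e) (choose-0 k) (newton-replicate-0 r 1 k))
          (trans (+-identityʳ (F [] * 1ℚ)) (*-identityʳ (F [])))
  constant : ∀ k → levelSum F k ≡ choose 0 k * N k
  constant zero    = sym (trans (cong (_* N 0) (choose-0 0)) (trans (*-identityˡ (N 0)) (N≡F[] 0)))
  constant (suc k) = sym (trans (cong (_* N (suc k)) (choose-0-suc k)) (*-zeroˡ (N (suc k))))
symmetrization {suc b} (suc r) F (F₀<r , ∂F<r)
  with symmetrization (suc r) (restrict₀ F) F₀<r | symmetrization r (∂ F) ∂F<r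
... | β₀ ∷ βs , L₀≡ | γs , L∂≡ = stepCoefficients b (β₀ ∷ βs) γs , levelSum≡
  where
  open ≡-Reasoning
  Q₀ Q∂ : ℕ → ℚ
  Q₀ = newton 0 (β₀ ∷ βs)
  Q∂ = newton 0 γs

  F₁≡F₀+∂F : ∀ y → F (true ∷ y) ≡ F (false ∷ y) + ∂ F y
  F₁≡F₀+∂F y = split (F (true ∷ y)) (F (false ∷ y))
    where
    split : ∀ a b → a ≡ b + (a - b)
    split = solve-∀ ℚ-ring

  levelSum≡ : ∀ k → levelSum F k ≡ choose (suc b) k * newton 0 (stepCoefficients b (β₀ ∷ βs) γs) k
  levelSum≡ zero    = trans (L₀≡ zero) (cong₂ _*_ (trans (choose-0 b) (sym (choose-0 (suc b))))
                                                  (sym (newton-stepCoefficients-0 b (β₀ ∷ βs) γs)))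
  levelSum≡ (suc k) = begin
    levelSum (restrict₀ F) (suc k) + levelSum (restrict₁ F) k
      ≡⟨ cong (λ e → levelSum (restrict₀ F) (suc k) + e)
              (trans (levelSum-cong F₁≡F₀+∂F k) (levelSum-+ (restrict₀ F) (∂ F) k)) ⟩
    levelSum (restrict₀ F) (suc k) + (levelSum (restrict₀ F) k + levelSum (∂ F) k)
      ≡⟨ cong₂ _+_ (trans (L₀≡ (suc k)) (cong (choose b (suc k) *_) (newton-Δ β₀ βs k)))
                   (cong₂ _+_ (L₀≡ k) (L∂≡ k)) ⟩
    choose b (suc k) * (Q₀ k + δ) + (choose b k * Q₀ k + choose b k * Q∂ k)
      ≡⟨ choose-recombine b k (Q₀ k) δ (Q∂ k) ⟩
    choose (suc b) (suc k) * ((Q₀ k + δ) + 1/[1+ b ] * (fromℕ (suc k) * (Q∂ k - δ)))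
      ≡⟨ cong (λ q → choose (suc b) (suc k) * (q + 1/[1+ b ] * (fromℕ (suc k) * (Q∂ k - δ)))) (sym (newton-Δ β₀ βs k)) ⟩
    choose (suc b) (suc k) * (Q₀ (suc k) + 1/[1+ b ] * (fromℕ (suc k) * (Q∂ k - δ)))
      ≡⟨ cong (choose (suc b) (suc k) *_) (sym (newton-stepCoefficients-suc b β₀ βs γs k)) ⟩
    choose (suc b) (suc k) * newton 0 (stepCoefficients b (β₀ ∷ βs) γs) (suc k) ∎
    where
    δ : ℚ
    δ = newton 0 βs k

-- Polynomials vanishing at 0 as k ↦ ⟨p, m_d(k)⟩

inner-cong : ∀ {d} (p : Fin d → ℚ) {q q′ : Fin d → ℚ} → (∀ i → q i ≡ q′ i) → inner p q ≡ inner p q′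
inner-cong {zero}  p q≗q′ = refl
inner-cong {suc d} p q≗q′ =
  cong₂ _+_ (cong (p zero *_) (q≗q′ zero)) (inner-cong (λ i → p (suc i)) (λ i → q≗q′ (suc i)))

inner-zeroˡ : ∀ {d} (q : Fin d → ℚ) → inner (λ _ → 0ℚ) q ≡ 0ℚ
inner-zeroˡ {zero}  q = refl
inner-zeroˡ {suc d} q rewrite inner-zeroˡ (λ i → q (suc i)) = trans (+-identityʳ (0ℚ * q zero)) (*-zeroˡ (q zero))

inner-+ˡ : ∀ {d} (p p′ q : Fin d → ℚ) → inner (λ i → p i + p′ i) q ≡ inner p q + inner p′ q
inner-+ˡ {zero}  p p′ q = sym (+-identityʳ 0ℚ)
inner-+ˡ {suc d} p p′ q rewrite inner-+ˡ (λ i → p (suc i)) (λ i → p′ (suc i)) (λ i → q (suc i)) =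
  distrib (p zero) (p′ zero) (q zero)
          (inner (λ i → p (suc i)) (λ i → q (suc i))) (inner (λ i → p′ (suc i)) (λ i → q (suc i)))
  where
  distrib : ∀ a a′ b x x′ → (a + a′) * b + (x + x′) ≡ (a * b + x) + (a′ * b + x′)
  distrib = solve-∀ ℚ-ring

inner-*ˡ : ∀ {d} (c : ℚ) (p q : Fin d → ℚ) → inner (λ i → c * p i) q ≡ c * inner p q
inner-*ˡ {zero}  c p q = sym (*-zeroʳ c)
inner-*ˡ {suc d} c p q rewrite inner-*ˡ c (λ i → p (suc i)) (λ i → q (suc i)) =
  distrib c (p zero) (q zero) (inner (λ i → p (suc i)) (λ i → q (suc i)))
  where
  distrib : ∀ c a b x → c * a * b + c * x ≡ c * (a * b + x)
  distrib = solve-∀ ℚ-ring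

inner-*ʳ : ∀ {d} (c : ℚ) (p q : Fin d → ℚ) → inner p (λ i → c * q i) ≡ c * inner p q
inner-*ʳ {zero}  c p q = sym (*-zeroʳ c)
inner-*ʳ {suc d} c p q rewrite inner-*ʳ c (λ i → p (suc i)) (λ i → q (suc i)) =
  distrib c (p zero) (q zero) (inner (λ i → p (suc i)) (λ i → q (suc i)))
  where
  distrib : ∀ c a b x → a * (c * b) + c * x ≡ c * (a * b + x)
  distrib = solve-∀ ℚ-ring

Representable : ℕ → (ℕ → ℚ) → Set
Representable d g = Σ (Fin d → ℚ) λ p → ∀ k → inner p (m d k) ≡ g k

Representable-cong : ∀ {d g h} → (∀ k → g k ≡ h k) → Representable d g → Representable d h
Representable-cong g≗h (p , p≗g) = p , λ k → trans (p≗g k) (g≗h k)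

Representable-zero : ∀ d → Representable d (λ _ → 0ℚ)
Representable-zero d = (λ _ → 0ℚ) , λ k → inner-zeroˡ (m d k)

Representable-+ : ∀ {d g h} → Representable d g → Representable d h → Representable d (λ k → g k + h k)
Representable-+ {d} (p , p≗g) (q , q≗h) =
  (λ i → p i + q i) , λ k → trans (inner-+ˡ p q (m d k)) (cong₂ _+_ (p≗g k) (q≗h k))

Representable-* : ∀ {d g} (c : ℚ) → Representable d g → Representable d (λ k → c * g k)
Representable-* {d} c (p , p≗g) = (λ i → c * p i) , λ k → trans (inner-*ˡ c p (m d k)) (cong (c *_) (p≗g k))

Representable-*k : ∀ {d g} → Representable d g → Representable (suc d) (λ k → fromℕ k * g k)
Representable-*k {d} {g} (p , p≗g) = shifted , λ k → begin
  0ℚ * fromℕ (k ^ 1) + inner p (λ i → m (suc d) k (suc i))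
    ≡⟨ cong₂ _+_ (*-zeroˡ (fromℕ (k ^ 1))) (inner-cong p (λ i → fromℕ-* k (k ^ suc (toℕ i)))) ⟩
  0ℚ + inner p (λ i → fromℕ k * m d k i)
    ≡⟨ +-identityˡ _ ⟩
  inner p (λ i → fromℕ k * m d k i)
    ≡⟨ inner-*ʳ (fromℕ k) p (m d k) ⟩
  fromℕ k * inner p (m d k)
    ≡⟨ cong (fromℕ k *_) (p≗g k) ⟩
  fromℕ k * g k ∎
  where
  open ≡-Reasoning
  shifted : Fin (suc d) → ℚ
  shifted zero    = 0ℚ
  shifted (suc i) = p i

padRight : ∀ {d} → (Fin d → ℚ) → Fin (suc d) → ℚ
padRight {zero}  p _       = 0ℚ
padRight {suc d} p zero    = p zero
padRight {suc d} p (suc i) = padRight (λ j → p (suc j)) i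

inner-padRight : ∀ {d} (p : Fin d → ℚ) (q : Fin (suc d) → ℚ) → inner (padRight p) q ≡ inner p (λ i → q (inject₁ i))
inner-padRight {zero}  p q = trans (+-identityʳ (0ℚ * q zero)) (*-zeroˡ (q zero))
inner-padRight {suc d} p q = cong (λ e → p zero * q zero + e) (inner-padRight (λ j → p (suc j)) (λ i → q (suc i)))

Representable-suc : ∀ {d g} → Representable d g → Representable (suc d) g
Representable-suc {d} (p , p≗g) = padRight p , λ k →
  trans (inner-padRight p (m (suc d) k))
        (trans (inner-cong p (λ i → cong (λ j → fromℕ (k ^ suc j)) (toℕ-inject₁ i))) (p≗g k))

Representable-mono : ∀ {d e g} → d ≤ e → Representable d g → Representable e g
Representable-mono d≤e rep with ℕ.≤⇒≤′ d≤e
... | ℕ.≤′-refl      = rep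
... | ℕ.≤′-step d≤′e = Representable-suc (Representable-mono (ℕ.≤′⇒≤ d≤′e) rep)

choose-representable : ∀ t → Representable (suc t) (λ k → choose k (suc t))
choose-representable zero    = (λ _ → 1ℚ) , λ k →
  trans (+-identityʳ (1ℚ * fromℕ (k ^ 1)))
        (trans (*-identityˡ (fromℕ (k ^ 1))) (trans (cong fromℕ (ℕ.*-identityʳ k)) (sym (choose-1 k))))
choose-representable (suc t) =
  Representable-cong solved
    (Representable-* 1/[1+ suc t ]
      (Representable-+ (Representable-*k (choose-representable t))
                       (Representable-* (- fromℕ (suc t)) (Representable-suc (choose-representable t)))))
  where
  open ≡-Reasoning
  solved : ∀ k → 1/[1+ suc t ] * (fromℕ k * choose k (suc t) + - fromℕ (suc t) * choose k (suc t)) ≡ choose k (suc (suc t))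
  solved k = begin
    1/[1+ suc t ] * (fromℕ k * C + - fromℕ (suc t) * C)
      ≡⟨ cong (1/[1+ suc t ] *_) (minus (fromℕ k) (fromℕ (suc t)) C) ⟩
    1/[1+ suc t ] * (fromℕ k * C - fromℕ (suc t) * C)
      ≡⟨ cong (1/[1+ suc t ] *_) (sym (choose-recurrence k t)) ⟩
    1/[1+ suc t ] * (fromℕ (suc (suc t)) * choose k (suc (suc t)))
      ≡⟨ sym (*-assoc 1/[1+ suc t ] (fromℕ (suc (suc t))) (choose k (suc (suc t)))) ⟩
    (1/[1+ suc t ] * fromℕ (suc (suc t))) * choose k (suc (suc t))
      ≡⟨ cong (_* choose k (suc (suc t))) (1/[1+n]*[1+n]≡1 (suc t)) ⟩
    1ℚ * choose k (suc (suc t))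
      ≡⟨ *-identityˡ (choose k (suc (suc t))) ⟩
    choose k (suc (suc t)) ∎
    where
    C : ℚ
    C = choose k (suc t)
    minus : ∀ a b c → a * c + - b * c ≡ a * c - b * c
    minus = solve-∀ ℚ-ring

newton-representable : ∀ d o {r} (βs : Vec ℚ r) → o ℕ.+ r ≤ d → Representable d (newton (suc o) βs)
newton-representable d o []       _ = Representable-zero d
newton-representable d o {suc r} (β ∷ βs) o+r<d =
  Representable-+ (Representable-* β (Representable-mono (ℕ.m+n≤o⇒m≤o (suc o) [1+o]+r≤d) (choose-representable o)))
                  (newton-representable d (suc o) βs [1+o]+r≤d)
  where
  [1+o]+r≤d : suc o ℕ.+ r ≤ d
  [1+o]+r≤d = subst (_≤ d) (ℕ.+-suc o r) o+r<d

levelSum-moments : ∀ {b d} (G : CubeFn b) → Deg< (suc d) G → G (replicate b false) ≡ 0ℚ →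
                   Σ (Fin d → ℚ) λ p → ∀ k → levelSum G k ≡ choose b k * inner p (m d k)
levelSum-moments {b} {d} G G<d G[0]≡0 with symmetrization (suc d) G G<d
... | β₀ ∷ βs , L≡ with newton-representable d 0 βs ℕ.≤-refl
...   | p , p≗N = p , λ k → begin
  levelSum G k                                   ≡⟨ L≡ k ⟩
  choose b k * (β₀ * choose k 0 + newton 1 βs k) ≡⟨ cong (λ β → choose b k * (β * choose k 0 + newton 1 βs k)) β₀≡0 ⟩
  choose b k * (0ℚ * choose k 0 + newton 1 βs k) ≡⟨ cong (λ e → choose b k * (e + newton 1 βs k)) (*-zeroˡ (choose k 0)) ⟩
  choose b k * (0ℚ + newton 1 βs k)              ≡⟨ cong (choose b k *_) (+-identityˡ (newton 1 βs k)) ⟩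
  choose b k * newton 1 βs k                     ≡⟨ cong (choose b k *_) (sym (p≗N k)) ⟩
  choose b k * inner p (m d k)                   ∎
  where
  open ≡-Reasoning
  β₀≡0 : β₀ ≡ 0ℚ
  β₀≡0 = begin
    β₀                                          ≡⟨ sym (*-identityʳ β₀) ⟩
    β₀ * 1ℚ                                     ≡⟨ cong (β₀ *_) (sym (choose-0 0)) ⟩
    β₀ * choose 0 0                             ≡⟨ sym (+-identityʳ (β₀ * choose 0 0)) ⟩
    β₀ * choose 0 0 + 0ℚ                        ≡⟨ cong (λ e → β₀ * choose 0 0 + e) (sym (newton-0 0 βs)) ⟩
    β₀ * choose 0 0 + newton 1 βs 0             ≡⟨ sym (*-identityˡ (β₀ * choose 0 0 + newton 1 βs 0)) ⟩
    1ℚ * (β₀ * choose 0 0 + newton 1 βs 0)      ≡⟨ cong (_* (β₀ * choose 0 0 + newton 1 βs 0)) (sym (choose-0 b)) ⟩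
    choose b 0 * (β₀ * choose 0 0 + newton 1 βs 0) ≡⟨ sym (L≡ 0) ⟩
    levelSum G 0                                ≡⟨ levelSum-0 G ⟩
    G (replicate b false)                       ≡⟨ G[0]≡0 ⟩
    0ℚ                                          ∎

-- Restricting f to the subcube spanned by disjoint blocks

meets : ∀ {b} → Cube b → (Fin b → Bool) → Bool
meets []       s = false
meets (y ∷ ys) s = (y ∧ s zero) ∨ meets ys (s ∘ suc)

blockUnion : ∀ {b n} → Cube b → (Fin b → Subset n) → Subset n
blockUnion {n = zero}  y B = []
blockUnion {n = suc n} y B = meets y (head ∘ B) ∷ blockUnion y (tail ∘ B)

AtMostOne : ∀ {b} → (Fin b → Bool) → Set
AtMostOne s = ∀ i j → i ≢ j → s i ∧ s j ≡ false

Disjoint : ∀ {b n} → (Fin b → Subset n) → Set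
Disjoint B = ∀ i j → i ≢ j → B i ∩ B j ≡ ⊥

Disjoint-head : ∀ {b n} (B : Fin b → Subset (suc n)) → Disjoint B → AtMostOne (head ∘ B)
Disjoint-head B disjoint i j i≢j with B i | B j | disjoint i j i≢j
... | _ ∷ _ | _ ∷ _ | Bi∩Bj≡⊥ = cong head Bi∩Bj≡⊥

Disjoint-tail : ∀ {b n} (B : Fin b → Subset (suc n)) → Disjoint B → Disjoint (tail ∘ B)
Disjoint-tail B disjoint i j i≢j with B i | B j | disjoint i j i≢j
... | _ ∷ _ | _ ∷ _ | Bi∩Bj≡⊥ = cong tail Bi∩Bj≡⊥

meets-none : ∀ {b} (y : Cube b) s → (∀ j → s j ≡ false) → meets y s ≡ false
meets-none []       s s≗false = refl
meets-none (y ∷ ys) s s≗false rewrite s≗false zero | meets-none ys (s ∘ suc) (s≗false ∘ suc) with y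
... | true  = refl
... | false = refl

-- With at most one s j set, the bit meets y s is either constant or a single coordinate of y.
literal-Deg< : ∀ {b} (a : Bool) (s : Fin b → Bool) → AtMostOne s → Deg< 2 (λ y → toℚ (a xor meets y s))
literal-Deg< {zero}  a s _        = tt
literal-Deg< {suc b} a s atMostOne =
  literal-Deg< a (s ∘ suc) (λ i j i≢j → atMostOne (suc i) (suc j) (i≢j ∘ suc-injective)) , ∂literal
  where
  ∂literal : Deg< 1 (λ y → toℚ (a xor ((true ∧ s zero) ∨ meets y (s ∘ suc)))
                         - toℚ (a xor ((false ∧ s zero) ∨ meets y (s ∘ suc))))
  ∂literal with s zero in s₀≡
  ... | false = Deg<-zero 1 (λ y → +-inverseʳ (toℚ (a xor meets y (s ∘ suc))))
  ... | true  = Deg<-cong 1 (λ y → cong (λ v → toℚ (a xor true) - toℚ (a xor v)) (sym (meets-none y (s ∘ suc) others)))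
                          (Deg<-const (toℚ (a xor true) - toℚ (a xor false)))
    where
    others : ∀ j → s (suc j) ≡ false
    others j = subst (λ v → v ∧ s (suc j) ≡ false) s₀≡ (atMostOne zero (suc j) (λ ()))

monomial-Deg< : ∀ {b n} (S : Subset n) (x₀ : Cube n) (B : Fin b → Subset n) → Disjoint B →
                Deg< (suc ∣ S ∣) (λ y → monomial S (flip x₀ (blockUnion y B)))
monomial-Deg< []          []       B _        = Deg<-const 1ℚ
monomial-Deg< (true ∷ S)  (a ∷ x₀) B disjoint =
  Deg<-* 1 ∣ S ∣ (literal-Deg< a (head ∘ B) (Disjoint-head B disjoint))
                 (monomial-Deg< S x₀ (tail ∘ B) (Disjoint-tail B disjoint))
monomial-Deg< (false ∷ S) (a ∷ x₀) B disjoint = monomial-Deg< S x₀ (tail ∘ B) (Disjoint-tail B disjoint)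

Deg<-sum : ∀ {b r} {A : Set} (F : A → CubeFn b) → (∀ a → Deg< r (F a)) →
           (as : List A) → Deg< r (λ y → sumℚ (List.map (λ a → F a y) as))
Deg<-sum {r = r} F F<r []       = Deg<-zero r (λ _ → refl)
Deg<-sum {r = r} F F<r (a ∷ as) = Deg<-+ r (F<r a) (Deg<-sum F F<r as)

eval-Deg< : ∀ {b n d} (c : Multilinear n) → (∀ S → c S ≢ 0ℚ → ∣ S ∣ ≤ d) →
            (x₀ : Cube n) (B : Fin b → Subset n) → Disjoint B →
            Deg< (suc d) (λ y → eval c (flip x₀ (blockUnion y B)))
eval-Deg< {d = d} c deg≤d x₀ B disjoint = Deg<-sum (λ S y → c S * monomial S (flip x₀ (blockUnion y B))) term (allVecs _)
  where
  term : ∀ S → Deg< (suc d) (λ y → c S * monomial S (flip x₀ (blockUnion y B)))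
  term S with c S ≟ 0ℚ
  ... | yes cS≡0 = Deg<-zero (suc d) (λ y → trans (cong (_* monomial S (flip x₀ (blockUnion y B))) cS≡0)
                                                  (*-zeroˡ (monomial S (flip x₀ (blockUnion y B)))))
  ... | no  cS≢0 = Deg<-scale (suc d) (c S) (Deg<-mono (s≤s (deg≤d S cS≢0)) (monomial-Deg< S x₀ B disjoint))

meets-zeros : ∀ {b} (s : Fin b → Bool) → meets (replicate b false) s ≡ false
meets-zeros {zero}  s = refl
meets-zeros {suc b} s = meets-zeros (s ∘ suc)

meets-unitVector : ∀ {b} (j : Fin b) s → meets (unitVector j) s ≡ s j
meets-unitVector {suc b} zero    s with s zero
... | true  = refl
... | false = meets-zeros (s ∘ suc)
meets-unitVector {suc b} (suc j) s = meets-unitVector j (s ∘ suc)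

blockUnion-zeros : ∀ {b n} (B : Fin b → Subset n) → blockUnion (replicate b false) B ≡ ⊥
blockUnion-zeros {n = zero}  B = refl
blockUnion-zeros {n = suc n} B = cong₂ _∷_ (meets-zeros (head ∘ B)) (blockUnion-zeros (tail ∘ B))

blockUnion-unitVector : ∀ {b n} (j : Fin b) (B : Fin b → Subset n) → blockUnion (unitVector j) B ≡ B j
blockUnion-unitVector {n = zero}  j B with B j
... | [] = refl
blockUnion-unitVector {n = suc n} j B with B j | meets-unitVector j (head ∘ B) | blockUnion-unitVector j (tail ∘ B)
... | _ ∷ _ | head≡ | tail≡ = cong₂ _∷_ head≡ tail≡

flip-⊥ : ∀ {n} (x : Cube n) → flip x ⊥ ≡ x
flip-⊥ []          = refl
flip-⊥ (true ∷ x)  = cong (true ∷_) (flip-⊥ x)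
flip-⊥ (false ∷ x) = cong (false ∷_) (flip-⊥ x)

xor-≢ : ∀ {x y} → x ≢ y → x xor y ≡ true
xor-≢ {x} {y} x≢y = trans (cong (_xor y) (¬-not x≢y)) (xor-inverseˡ y)

toℚ-not : ∀ v → toℚ (not v) ≡ 1ℚ - toℚ v
toℚ-not true  = refl
toℚ-not false = refl

toℚ∈[0,1] : ∀ v → 0ℚ ≤ℚ toℚ v × toℚ v ≤ℚ 1ℚ
toℚ∈[0,1] true  = nonNegative⁻¹ 1ℚ , ≤-refl
toℚ∈[0,1] false = ≤-refl , nonNegative⁻¹ 1ℚ

blockChange : ∀ {n b} → BoolFun n → Cube n → (Fin b → Subset n) → CubeFn b
blockChange f x₀ B y = toℚ (f x₀ xor f (flip x₀ (blockUnion y B)))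

blockChange-origin : ∀ {n b} (f : BoolFun n) x₀ (B : Fin b → Subset n) → blockChange f x₀ B (replicate b false) ≡ 0ℚ
blockChange-origin f x₀ B = begin
  toℚ (f x₀ xor f (flip x₀ (blockUnion (replicate _ false) B)))
    ≡⟨ cong (λ S → toℚ (f x₀ xor f (flip x₀ S))) (blockUnion-zeros B) ⟩
  toℚ (f x₀ xor f (flip x₀ ⊥))
    ≡⟨ cong (λ x → toℚ (f x₀ xor f x)) (flip-⊥ x₀) ⟩
  toℚ (f x₀ xor f x₀)
    ≡⟨ cong toℚ (xor-same (f x₀)) ⟩
  0ℚ                                                           ∎
  where open ≡-Reasoning

blockChange-unitVector : ∀ {n b} (f : BoolFun n) x₀ (B : Fin b → Subset n) → (∀ j → f x₀ ≢ f (flip x₀ (B j))) →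
                         ∀ j → blockChange f x₀ B (unitVector j) ≡ 1ℚ
blockChange-unitVector f x₀ B sensitive j =
  trans (cong (λ S → toℚ (f x₀ xor f (flip x₀ S))) (blockUnion-unitVector j B)) (cong toℚ (xor-≢ (sensitive j)))

blockChange∈[0,1] : ∀ {n b} (f : BoolFun n) x₀ (B : Fin b → Subset n) →
                    ∀ y → 0ℚ ≤ℚ blockChange f x₀ B y × blockChange f x₀ B y ≤ℚ 1ℚ
blockChange∈[0,1] f x₀ B y = toℚ∈[0,1] (f x₀ xor f (flip x₀ (blockUnion y B)))

blockChange-Deg< : ∀ {n b d} {f : BoolFun n} → Degree f d → ∀ x₀ (B : Fin b → Subset n) → Disjoint B →
                   Deg< (suc d) (blockChange f x₀ B)
blockChange-Deg< {n} {d = d} {f} (c , represents , deg≤d , _) x₀ B disjoint with f x₀ | eval-Deg< c deg≤d x₀ B disjoint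
... | false | eval<d = Deg<-cong (suc d) (λ y → represents (flip x₀ (blockUnion y B))) eval<d
... | true  | eval<d =
  Deg<-cong (suc d) complement (Deg<-+ (suc d) (Deg<-mono (s≤s z≤n) (Deg<-const 1ℚ)) (Deg<-scale (suc d) (- 1ℚ) eval<d))
  where
  complement : ∀ y → 1ℚ + - 1ℚ * eval c (flip x₀ (blockUnion y B)) ≡ toℚ (not (f (flip x₀ (blockUnion y B))))
  complement y = trans (1-x (eval c x)) (trans (cong (λ v → 1ℚ - v) (represents x)) (sym (toℚ-not (f x))))
    where
    x : Cube n
    x = flip x₀ (blockUnion y B)
    1-x : ∀ x → 1ℚ + - 1ℚ * x ≡ 1ℚ - x
    1-x = solve-∀ ℚ-ring

proposition1 : (d b : ℕ) → 1 ≤ d → 1 ≤ b →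
    (∃ λ n → Σ (BoolFun n) λ f → Degree f d × BlockSensitivity f b) →
    Σ Bool λ τ → Σ (Fin d → ℚ) λ p →
      inner p (m d 1) ≡ 1ℚ ×
      (∀ k → 2 ≤ k → k < b → 0ℚ ≤ℚ inner p (m d k) × inner p (m d k) ≤ℚ 1ℚ) ×
      inner p (m d b) ≡ toℚ τ
proposition1 d b _ 1≤b (n , f , deg-f , (x₀ , B , disjoint , sensitive) , _)
  with levelSum-moments (blockChange f x₀ B) (blockChange-Deg< {f = f} deg-f x₀ B disjoint) (blockChange-origin f x₀ B)
... | p , L≡ = τ , p , level-1 , middle-level , level-b
  where
  open ≡-Reasoning
  G : CubeFn b
  G = blockChange f x₀ B
  τ : Bool
  τ = f x₀ xor f (flip x₀ (blockUnion (replicate b true) B))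
  level-1 : inner p (m d 1) ≡ 1ℚ
  level-1 = *-cancelˡ-≡-pos (fromℕ b) {{fromℕ-positive b {{ℕ.>-nonZero 1≤b}}}} (begin
    fromℕ b * inner p (m d 1)  ≡⟨ cong (_* inner p (m d 1)) (sym (choose-1 b)) ⟩
    choose b 1 * inner p (m d 1) ≡⟨ sym (L≡ 1) ⟩
    levelSum G 1               ≡⟨ levelSum-1 G (blockChange-unitVector f x₀ B sensitive) ⟩
    fromℕ b                    ≡⟨ sym (*-identityʳ (fromℕ b)) ⟩
    fromℕ b * 1ℚ               ∎)
  middle-level : ∀ k → 2 ≤ k → k < b → 0ℚ ≤ℚ inner p (m d k) × inner p (m d k) ≤ℚ 1ℚ
  middle-level k _ k<b = *-cancelˡ-∈[0,1] (choose b k) {{choose-positive (ℕ.<⇒≤ k<b)}}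
    (subst (λ L → 0ℚ ≤ℚ L × L ≤ℚ choose b k) (L≡ k) (levelSum-bounded G (blockChange∈[0,1] f x₀ B) k))
  level-b : inner p (m d b) ≡ toℚ τ
  level-b = begin
    inner p (m d b)              ≡⟨ sym (*-identityˡ (inner p (m d b))) ⟩
    1ℚ * inner p (m d b)         ≡⟨ cong (_* inner p (m d b)) (sym (choose-diag b)) ⟩
    choose b b * inner p (m d b) ≡⟨ sym (L≡ b) ⟩
    levelSum G b                 ≡⟨ levelSum-top G ⟩
    G (replicate b true)         ∎
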